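{- Let $n,k$ be positive integers with $1<k\le n-1$ and $1<k<\sqrt n$, and let $L$ be a $\mathbb{Z}$-lattice with $\min(L)\ge 2$. If $\phi: A_{n,k}\to I_{n-1}\perp L$ is a representation, then $\phi(A_{n,k})\subset L$.
   Context: All $\mathbb{Z}$-lattices are positive definite with integral Gram matrix; a representation $\phi:M\to L$ is a linear map with $Q(\phi(x))=Q(x)$ for all $x$; $\min(L)=\min\{Q(x):0\ne x\in L\}$. $I_n=\mathbb{Z}e_1+\dots+\mathbb{Z}e_n$ with $B(e_i,e_j)=\delta_{ij}$. For $1<k\le n-1$, $A_{n,k}$ is the sublattice of $I_n$ given by $A_{n,k}=\mathbb{Z}(-e_1+e_2)+\dots+\mathbb{Z}(-e_{n-1}+e_n)+\mathbb{Z}(-(e_{n-k+1}+\dots+e_n))$ (a sublattice of index $k$ in $I_n$). In $I_{n-1}\perp L$, $L$ is regarded as the second orthogonal summand. -}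

module Defs where

open import Data.Nat as ℕ using (ℕ; zero; suc; _∸_; _<?_; _≤?_)
open import Data.Integer as ℤ using (ℤ; +_; -_; _+_; _*_; _<_; _≤_)
open import Data.Fin using (Fin; toℕ)
open import Data.Fin as F using ()
open import Data.Product using (_×_; _,_; proj₁; proj₂)
open import Relation.Nullary using (¬_; yes; no)
open import Relation.Binary.PropositionalEquality using (_≡_)

Vec : ℕ → Set
Vec m = Fin m → ℤ

∑ : (m : ℕ) → (Fin m → ℤ) → ℤ
∑ zero    f = + 0
∑ (suc m) f = f F.zero + ∑ m (λ i → f (F.suc i))

IsZero : {m : ℕ} → Vec m → Set
IsZero {m} x = (i : Fin m) → x i ≡ + 0

-- A ℤ-lattice of rank m given by its (integral) Gram matrix w.r.t. a basis:
-- symmetric and positive definite.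
record ZLattice : Set where
  field
    rank : ℕ
    gram : Fin rank → Fin rank → ℤ
    sym  : (i j : Fin rank) → gram i j ≡ gram j i
  Q : Vec rank → ℤ
  Q x = ∑ rank (λ i → ∑ rank (λ j → x i * gram i j * x j))
  field
    posdef : (x : Vec rank) → ¬ IsZero x → + 0 < Q x

open ZLattice public

MinAtLeast2 : ZLattice → Set
MinAtLeast2 L = (x : Vec (rank L)) → ¬ IsZero x → + 2 ≤ Q L x

Q-I : (m : ℕ) → Vec m → ℤ
Q-I m x = ∑ m (λ j → x j * x j)

-- The basis b_0..b_{n-1} of A_{n,k} in coordinates of I_n (0-indexed):
--   b_i = -e_i + e_{i+1}  for i < n-1,
--   b_{n-1} = -(e_{n-k} + ... + e_{n-1}).
basisA : (n k : ℕ) → Fin n → Vec n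
basisA n k i j with toℕ i <? n ∸ 1
... | yes _ with toℕ j ℕ.≟ toℕ i
...   | yes _ = - (+ 1)
...   | no _ with toℕ j ℕ.≟ suc (toℕ i)
...     | yes _ = + 1
...     | no _ = + 0
basisA n k i j | no _ with n ∸ k ≤? toℕ j
...   | yes _ = - (+ 1)
...   | no _ = + 0

elemA : (n k : ℕ) → Vec n → Vec n
elemA n k c j = ∑ n (λ i → c i * basisA n k i j)

Q-A : (n k : ℕ) → Vec n → ℤ
Q-A n k c = Q-I n (elemA n k c)

Perp : ℕ → ZLattice → Set
Perp p L = Vec p × Vec (rank L)

Q-Perp : (p : ℕ) (L : ZLattice) → Perp p L → ℤ
Q-Perp p L (y , z) = Q-I p y + Q L z

-- the ℤ-linear map A_{n,k} → I_p ⊥ L determined by images v of the basis b_i,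
-- applied to Σ c_i b_i
linExt : (n p : ℕ) (L : ZLattice) → (Fin n → Perp p L) → Vec n → Perp p L
linExt n p L v c =
  (λ j → ∑ n (λ i → c i * proj₁ (v i) j)) , (λ j → ∑ n (λ i → c i * proj₂ (v i) j))

IsRepresentation : (n k p : ℕ) (L : ZLattice) → (Fin n → Perp p L) → Set
IsRepresentation n k p L v =
  (c : Vec n) → Q-Perp p L (linExt n p L v c) ≡ Q-A n k c

module Submission where

-- Each root b_i = e_{i+1} − e_i has norm 2 and min L ≥ 2, so φ sends it entirely into I_{n−1}
-- or entirely into L; since b_i + b_{i+1} has norm 2 as well, adjacent roots land in the same
-- summand, hence all roots do. The vector k(e_1 + ⋯ + e_n) ∈ A_{n,k} has coefficient −n on the
-- last basis vector and norm nk² < n², which forces the image of the last basis vector into that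
-- summand too. If the summand is L we are done. If it is I_{n−1}, then φ is an isometry into
-- I_{n−1} carrying the n pairwise orthogonal vectors k e_t of norm k² to n such vectors of ℤ^{n−1},
-- which is impossible.

open import Defs

-- ℤ arithmetic is opened only inside this block: the statement of lemma4p1 uses ℕ's _*_, _<_, _≤_.
module _ where
  open import Data.Empty using (⊥; ⊥-elim)
  open import Data.Fin using (Fin; zero; suc; toℕ; inject₁; fromℕ)
  open import Data.Fin.Induction using (<-weakInduction)
  import Data.Fin.Properties as Finₚ
  open import Data.Integer as ℤ
    using (ℤ; +_; -_; _+_; _-_; _*_; _≤_; _<_; 0ℤ; 1ℤ; -1ℤ; +0; +[1+_]; -[1+_])
  import Data.Integer.Properties as ℤₚ
  open import Data.Integer.Tactic.RingSolver using (solve-∀)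
  open import Algebra.Properties.AbelianGroup ℤₚ.+-0-abelianGroup using (∙-cancelˡ)
  open import Algebra.Properties.Semiring.Sum ℤₚ.+-*-semiring
    using (sum; sum-cong-≗; ∑-distrib-+; ∑-comm; *-distribˡ-sum; sum-init-last)
  open import Data.Nat as ℕ using (ℕ; zero; suc; z≤n; s≤s; _∸_)
  import Data.Nat.Properties as ℕₚ
  open import Data.Product using (_×_; _,_; proj₁; proj₂)
  open import Data.Sum using (_⊎_; inj₁; inj₂)
  open import Data.Vec.Functional using (transpose)
  open import Function using (_∘_)
  open import Relation.Binary.PropositionalEquality as ≡
    using (_≡_; _≢_; _≗_; refl; trans; cong; cong₂; subst; subst₂; module ≡-Reasoning)
  open import Relation.Nullary using (yes; no; contradiction)
  open ≡-Reasoning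

  -- Finite sums

  ∑≡sum : ∀ m (f : Fin m → ℤ) → ∑ m f ≡ sum f
  ∑≡sum zero    f = refl
  ∑≡sum (suc m) f = cong (_+_ (f zero)) (∑≡sum m (f ∘ suc))

  ∑-cong : ∀ m {f g : Fin m → ℤ} → f ≗ g → ∑ m f ≡ ∑ m g
  ∑-cong m {f} {g} f≗g rewrite ∑≡sum m f | ∑≡sum m g = sum-cong-≗ f≗g

  ∑-+ : ∀ m (f g : Fin m → ℤ) → ∑ m (λ i → f i + g i) ≡ ∑ m f + ∑ m g
  ∑-+ m f g rewrite ∑≡sum m f | ∑≡sum m g | ∑≡sum m (λ i → f i + g i) = ∑-distrib-+ f g

  *-distribˡ-∑ : ∀ m a (f : Fin m → ℤ) → a * ∑ m f ≡ ∑ m (λ i → a * f i)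
  *-distribˡ-∑ m a f rewrite ∑≡sum m f | ∑≡sum m (λ i → a * f i) = *-distribˡ-sum a f

  ∑-init-last : ∀ m (f : Fin (suc m) → ℤ) → ∑ (suc m) f ≡ ∑ m (f ∘ inject₁) + f (fromℕ m)
  ∑-init-last m f rewrite ∑≡sum (suc m) f | ∑≡sum m (f ∘ inject₁) = sum-init-last f

  ∑-swap : ∀ m p (f : Fin m → Fin p → ℤ) → ∑ m (λ i → ∑ p (f i)) ≡ ∑ p (λ j → ∑ m (λ i → f i j))
  ∑-swap m p f = begin
    ∑ m (λ i → ∑ p (f i))          ≡⟨ ∑≡sum m _ ⟩
    sum (λ i → ∑ p (f i))          ≡⟨ sum-cong-≗ (λ i → ∑≡sum p (f i)) ⟩
    sum (λ i → sum (f i))          ≡⟨ ∑-comm f ⟩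
    sum (λ j → sum (λ i → f i j))  ≡⟨ sum-cong-≗ (λ j → ∑≡sum m (λ i → f i j)) ⟨
    sum (λ j → ∑ m (λ i → f i j))  ≡⟨ ∑≡sum p _ ⟨
    ∑ p (λ j → ∑ m (λ i → f i j))  ∎

  ∑-const : ∀ m c → ∑ m (λ _ → c) ≡ + m * c
  ∑-const zero    c = ≡.sym (ℤₚ.*-zeroˡ c)
  ∑-const (suc m) c = begin
    c + ∑ m (λ _ → c)  ≡⟨ cong (_+_ c) (∑-const m c) ⟩
    c + + m * c        ≡⟨ cong (_+ + m * c) (ℤₚ.*-identityˡ c) ⟨
    1ℤ * c + + m * c   ≡⟨ ℤₚ.*-distribʳ-+ c 1ℤ (+ m) ⟨
    + suc m * c        ∎

  ∑-zero : ∀ m {f : Fin m → ℤ} → (∀ i → f i ≡ 0ℤ) → ∑ m f ≡ 0ℤ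
  ∑-zero m f≡0 = trans (∑-cong m f≡0) (trans (∑-const m 0ℤ) (ℤₚ.*-zeroʳ (+ m)))

  ∑-neg : ∀ m (f : Fin m → ℤ) → ∑ m (λ i → - f i) ≡ - ∑ m f
  ∑-neg m f = begin
    ∑ m (λ i → - f i)      ≡⟨ ∑-cong m (λ i → ℤₚ.-1*i≡-i (f i)) ⟨
    ∑ m (λ i → -1ℤ * f i)  ≡⟨ *-distribˡ-∑ m -1ℤ f ⟨
    -1ℤ * ∑ m f            ≡⟨ ℤₚ.-1*i≡-i (∑ m f) ⟩
    - ∑ m f                ∎

  ∑-- : ∀ m (f g : Fin m → ℤ) → ∑ m (λ i → f i - g i) ≡ ∑ m f - ∑ m g
  ∑-- m f g = trans (∑-+ m f (λ i → - g i)) (cong (_+_ (∑ m f)) (∑-neg m g))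

  ∑-mul : ∀ m p (f : Fin m → ℤ) (g : Fin p → ℤ) → ∑ m f * ∑ p g ≡ ∑ m (λ i → ∑ p (λ j → f i * g j))
  ∑-mul m p f g = begin
    ∑ m f * ∑ p g                      ≡⟨ ℤₚ.*-comm (∑ m f) (∑ p g) ⟩
    ∑ p g * ∑ m f                      ≡⟨ *-distribˡ-∑ m (∑ p g) f ⟩
    ∑ m (λ i → ∑ p g * f i)            ≡⟨ ∑-cong m (λ i → ℤₚ.*-comm (∑ p g) (f i)) ⟩
    ∑ m (λ i → f i * ∑ p g)            ≡⟨ ∑-cong m (λ i → *-distribˡ-∑ p (f i) g) ⟩
    ∑ m (λ i → ∑ p (λ j → f i * g j))  ∎

  ∑-nonneg : ∀ m {f : Fin m → ℤ} → (∀ i → 0ℤ ≤ f i) → 0ℤ ≤ ∑ m f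
  ∑-nonneg zero    _   = ℤₚ.≤-refl
  ∑-nonneg (suc m) f≥0 = ℤₚ.+-mono-≤ (f≥0 zero) (∑-nonneg m (f≥0 ∘ suc))

  ∑-mono-≤ : ∀ m {f g : Fin m → ℤ} → (∀ i → f i ≤ g i) → ∑ m f ≤ ∑ m g
  ∑-mono-≤ zero    _   = ℤₚ.≤-refl
  ∑-mono-≤ (suc m) f≤g = ℤₚ.+-mono-≤ (f≤g zero) (∑-mono-≤ m (f≤g ∘ suc))

  term≤∑ : ∀ m {f : Fin m → ℤ} → (∀ i → 0ℤ ≤ f i) → ∀ i → f i ≤ ∑ m f
  term≤∑ (suc m) {f} f≥0 zero =
    ℤₚ.≤-trans (ℤₚ.≤-reflexive (≡.sym (ℤₚ.+-identityʳ (f zero))))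
               (ℤₚ.+-monoʳ-≤ (f zero) (∑-nonneg m (f≥0 ∘ suc)))
  term≤∑ (suc m) {f} f≥0 (suc i) =
    ℤₚ.i≤j⇒i≤k+j (f zero) ⦃ ℤ.nonNegative (f≥0 zero) ⦄ (term≤∑ m (f≥0 ∘ suc) i)

  ∑-swap₄ : ∀ N M (h : Fin N → Fin N → Fin M → Fin M → ℤ) →
    ∑ N (λ s → ∑ N (λ t → ∑ M (λ x → ∑ M (λ y → h s t x y))))
      ≡ ∑ M (λ x → ∑ M (λ y → ∑ N (λ s → ∑ N (λ t → h s t x y))))
  ∑-swap₄ N M h = begin
    ∑ N (λ s → ∑ N (λ t → ∑ M (λ x → ∑ M (λ y → h s t x y))))
      ≡⟨ ∑-cong N (λ s → ∑-swap N M (λ t x → ∑ M (h s t x))) ⟩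
    ∑ N (λ s → ∑ M (λ x → ∑ N (λ t → ∑ M (λ y → h s t x y))))
      ≡⟨ ∑-swap N M (λ s x → ∑ N (λ t → ∑ M (h s t x))) ⟩
    ∑ M (λ x → ∑ N (λ s → ∑ N (λ t → ∑ M (λ y → h s t x y))))
      ≡⟨ ∑-cong M (λ x → ∑-cong N (λ s → ∑-swap N M (λ t y → h s t x y))) ⟩
    ∑ M (λ x → ∑ N (λ s → ∑ M (λ y → ∑ N (λ t → h s t x y))))
      ≡⟨ ∑-cong M (λ x → ∑-swap N M (λ s y → ∑ N (λ t → h s t x y))) ⟩
    ∑ M (λ x → ∑ M (λ y → ∑ N (λ s → ∑ N (λ t → h s t x y))))  ∎

  δ : ℕ → ℕ → ℤ
  δ zero    zero    = 1ℤ
  δ zero    (suc _) = 0ℤ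
  δ (suc _) zero    = 0ℤ
  δ (suc a) (suc b) = δ a b

  δ-refl : ∀ a → δ a a ≡ 1ℤ
  δ-refl zero    = refl
  δ-refl (suc a) = δ-refl a

  δ-≢ : ∀ {a b} → a ≢ b → δ a b ≡ 0ℤ
  δ-≢ {zero}  {zero}  a≢b = contradiction refl a≢b
  δ-≢ {zero}  {suc b} _   = refl
  δ-≢ {suc a} {zero}  _   = refl
  δ-≢ {suc a} {suc b} a≢b = δ-≢ (a≢b ∘ cong suc)

  δ-sym : ∀ a b → δ a b ≡ δ b a
  δ-sym zero    zero    = refl
  δ-sym zero    (suc b) = refl
  δ-sym (suc a) zero    = refl
  δ-sym (suc a) (suc b) = δ-sym a b

  δ-product : ∀ j s t → δ j s * δ j t ≡ δ j s * δ s t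
  δ-product j s t with j ℕ.≟ s
  ... | yes refl = refl
  ... | no j≢s rewrite δ-≢ j≢s = trans (ℤₚ.*-zeroˡ (δ j t)) (≡.sym (ℤₚ.*-zeroˡ (δ s t)))

  step : ℕ → ℕ → ℤ
  step zero    _       = 1ℤ
  step (suc _) zero    = 0ℤ
  step (suc N) (suc b) = step N b

  step-≤ : ∀ {N b} → N ℕ.≤ b → step N b ≡ 1ℤ
  step-≤ z≤n       = refl
  step-≤ (s≤s N≤b) = step-≤ N≤b

  step-> : ∀ {N b} → b ℕ.< N → step N b ≡ 0ℤ
  step-> {suc N} {zero}  _         = refl
  step-> {suc N} {suc b} (s≤s b<N) = step-> b<N

  step-suc : ∀ t b → step t b ≡ step (suc t) b + δ b t
  step-suc zero    zero    = refl
  step-suc zero    (suc b) = refl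
  step-suc (suc t) zero    = refl
  step-suc (suc t) (suc b) = step-suc t b

  -- e a is the zero vector when a ≥ n.
  e : ∀ {n} → ℕ → Vec n
  e a j = δ (toℕ j) a

  ∑-δ-< : ∀ m (g : ℕ → ℤ) {b} → b ℕ.< m → ∑ m (λ i → δ (toℕ i) b * g (toℕ i)) ≡ g b
  ∑-δ-< (suc m) g {zero}  _         = begin
    1ℤ * g 0 + ∑ m (λ i → 0ℤ * g (suc (toℕ i)))
      ≡⟨ cong₂ _+_ (ℤₚ.*-identityˡ (g 0)) (∑-zero m (λ i → ℤₚ.*-zeroˡ (g (suc (toℕ i))))) ⟩
    g 0 + 0ℤ  ≡⟨ ℤₚ.+-identityʳ (g 0) ⟩
    g 0       ∎
  ∑-δ-< (suc m) g {suc b} (s≤s b<m) = trans (ℤₚ.+-identityˡ _) (∑-δ-< m (g ∘ suc) b<m)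

  ∑-δ-≥ : ∀ m (g : ℕ → ℤ) {b} → m ℕ.≤ b → ∑ m (λ i → δ (toℕ i) b * g (toℕ i)) ≡ 0ℤ
  ∑-δ-≥ zero    g _         = refl
  ∑-δ-≥ (suc m) g (s≤s m≤b) = trans (ℤₚ.+-identityˡ _) (∑-δ-≥ m (g ∘ suc) m≤b)

  ∑-δ-≤ : ∀ m (g : ℕ → ℤ) {b} → b ℕ.≤ m → g m ≡ 0ℤ → ∑ m (λ a → δ (toℕ a) b * g (toℕ a)) ≡ g b
  ∑-δ-≤ m g b≤m gm≡0 with ℕₚ.m≤n⇒m<n∨m≡n b≤m
  ... | inj₁ b<m  = ∑-δ-< m g b<m
  ... | inj₂ refl = trans (∑-δ-≥ m g ℕₚ.≤-refl) (≡.sym gm≡0)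

  ∑-δ-suc : ∀ m (g : ℕ → ℤ) {b} → b ℕ.≤ m → g 0 ≡ 0ℤ →
    ∑ m (λ a → δ (suc (toℕ a)) b * g (suc (toℕ a))) ≡ g b
  ∑-δ-suc m g {zero}  _   g0≡0 = trans (∑-zero m (λ a → ℤₚ.*-zeroˡ (g (suc (toℕ a))))) (≡.sym g0≡0)
  ∑-δ-suc m g {suc b} b<m _    = ∑-δ-< m (g ∘ suc) b<m

  ∑-δ : ∀ m (g : Fin m → ℤ) q → ∑ m (λ i → δ (toℕ i) (toℕ q) * g i) ≡ g q
  ∑-δ (suc m) g zero    = begin
    1ℤ * g zero + ∑ m (λ i → 0ℤ * g (suc i))
      ≡⟨ cong₂ _+_ (ℤₚ.*-identityˡ (g zero)) (∑-zero m (λ i → ℤₚ.*-zeroˡ (g (suc i)))) ⟩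
    g zero + 0ℤ  ≡⟨ ℤₚ.+-identityʳ (g zero) ⟩
    g zero       ∎
  ∑-δ (suc m) g (suc q) = trans (ℤₚ.+-identityˡ _) (∑-δ m (g ∘ suc) q)

  -- The standard lattice ℤᴹ

  square-nonneg : ∀ i → 0ℤ ≤ i * i
  square-nonneg +0       = ℤₚ.≤-refl
  square-nonneg +[1+ n ] = ℤ.+≤+ z≤n
  square-nonneg -[1+ n ] = ℤ.+≤+ z≤n

  square≡0 : ∀ i → i * i ≡ 0ℤ → i ≡ 0ℤ
  square≡0 i i*i≡0 with ℤₚ.i*j≡0⇒i≡0∨j≡0 i i*i≡0
  ... | inj₁ i≡0 = i≡0
  ... | inj₂ i≡0 = i≡0

  infix 8 _·_
  _·_ : ∀ {M} → Vec M → Vec M → ℤ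
  _·_ {M} x y = ∑ M (λ j → x j * y j)

  ·-cong : ∀ {M} {x x′ y y′ : Vec M} → x ≗ x′ → y ≗ y′ → x · y ≡ x′ · y′
  ·-cong {M} x≗x′ y≗y′ = ∑-cong M (λ j → cong₂ _*_ (x≗x′ j) (y≗y′ j))

  Q-I-cong : ∀ M {x y : Vec M} → x ≗ y → Q-I M x ≡ Q-I M y
  Q-I-cong M x≗y = ·-cong x≗y x≗y

  Q-I-zero : ∀ M {x : Vec M} → IsZero x → Q-I M x ≡ 0ℤ
  Q-I-zero M x≡0 = ∑-zero M (λ j → cong₂ _*_ (x≡0 j) (x≡0 j))

  Q-I-nonneg : ∀ M x → 0ℤ ≤ Q-I M x
  Q-I-nonneg M x = ∑-nonneg M (λ j → square-nonneg (x j))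

  Q-I≡0⇒IsZero : ∀ M x → Q-I M x ≡ 0ℤ → IsZero x
  Q-I≡0⇒IsZero M x Q≡0 j =
    square≡0 (x j) (ℤₚ.≤-antisym (ℤₚ.≤-trans x²≤Q (ℤₚ.≤-reflexive Q≡0)) (square-nonneg (x j)))
    where x²≤Q = term≤∑ M (λ j → square-nonneg (x j)) j

  Q-I-scale : ∀ M a (x : Vec M) → Q-I M (λ j → a * x j) ≡ a * a * Q-I M x
  Q-I-scale M a x = begin
    ∑ M (λ j → a * x j * (a * x j))  ≡⟨ ∑-cong M (λ j → reorder a (x j)) ⟩
    ∑ M (λ j → a * a * (x j * x j))  ≡⟨ *-distribˡ-∑ M (a * a) _ ⟨
    a * a * Q-I M x                  ∎
    where reorder : ∀ a b → a * b * (a * b) ≡ a * a * (b * b)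
          reorder = solve-∀

  Q-I-+ : ∀ M (x y : Vec M) → Q-I M (λ j → x j + y j) ≡ Q-I M x + Q-I M y + + 2 * (x · y)
  Q-I-+ M x y = begin
    ∑ M (λ j → (x j + y j) * (x j + y j))                   ≡⟨ ∑-cong M (λ j → expand (x j) (y j)) ⟩
    ∑ M (λ j → x j * x j + y j * y j + + 2 * (x j * y j))  ≡⟨ ∑-+ M _ _ ⟩
    ∑ M (λ j → x j * x j + y j * y j) + ∑ M (λ j → + 2 * (x j * y j))
      ≡⟨ cong₂ _+_ (∑-+ M _ _) (≡.sym (*-distribˡ-∑ M (+ 2) _)) ⟩
    Q-I M x + Q-I M y + + 2 * (x · y)                      ∎
    where expand : ∀ a b → (a + b) * (a + b) ≡ a * a + b * b + + 2 * (a * b)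
          expand = solve-∀

  ·-scaled-basis : ∀ n α β {s} t → s ℕ.< n → ∑ n (λ j → α * e s j * (β * e t j)) ≡ α * β * δ s t
  ·-scaled-basis n α β {s} t s<n = begin
    ∑ n (λ j → α * e s j * (β * e t j))  ≡⟨ ∑-cong n (λ j → pointwise (toℕ j)) ⟩
    ∑ n (λ j → e s j * (α * β * δ s t))  ≡⟨ ∑-δ-< n (λ _ → α * β * δ s t) s<n ⟩
    α * β * δ s t                        ∎
    where
    reorder : ∀ a b d e → a * d * (b * e) ≡ a * b * (d * e)
    reorder = solve-∀
    reorder′ : ∀ a b d e → a * b * (d * e) ≡ d * (a * b * e)
    reorder′ = solve-∀
    pointwise : ∀ j → α * δ j s * (β * δ j t) ≡ δ j s * (α * β * δ s t)
    pointwise j = begin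
      α * δ j s * (β * δ j t)    ≡⟨ reorder α β (δ j s) (δ j t) ⟩
      α * β * (δ j s * δ j t)    ≡⟨ cong (α * β *_) (δ-product j s t) ⟩
      α * β * (δ j s * δ s t)    ≡⟨ reorder′ α β (δ j s) (δ s t) ⟩
      δ j s * (α * β * δ s t)    ∎

  Q-I-basis-diff : ∀ n {a b} → a ≢ b → a ℕ.< n → b ℕ.< n → Q-I n (λ j → e a j - e b j) ≡ + 2
  Q-I-basis-diff n {a} {b} a≢b a<n b<n = begin
    Q-I n (λ j → e a j - e b j)          ≡⟨ Q-I-cong n (λ j → as-sum (e a j) (e b j)) ⟩
    Q-I n (λ j → x j + y j)              ≡⟨ Q-I-+ n x y ⟩
    x · x + y · y + + 2 * (x · y)
      ≡⟨ cong₂ (λ p q → p + q + + 2 * (x · y))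
               (·-scaled-basis n 1ℤ 1ℤ a a<n) (·-scaled-basis n -1ℤ -1ℤ b b<n) ⟩
    1ℤ * 1ℤ * δ a a + -1ℤ * -1ℤ * δ b b + + 2 * (x · y)
      ≡⟨ cong₂ (λ p q → 1ℤ * 1ℤ * p + -1ℤ * -1ℤ * q + + 2 * (x · y)) (δ-refl a) (δ-refl b) ⟩
    + 2 + + 2 * (x · y)
      ≡⟨ cong (λ p → + 2 + + 2 * p) (trans (·-scaled-basis n 1ℤ -1ℤ b a<n) (cong (-1ℤ *_) (δ-≢ a≢b))) ⟩
    + 2                                  ∎
    where
    x y : Vec n
    x j = 1ℤ * e a j
    y j = -1ℤ * e b j
    as-sum : ∀ p q → p - q ≡ 1ℤ * p + -1ℤ * q
    as-sum = solve-∀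

  ∑∑-square-diff : ∀ M (x : Vec M) →
    ∑ M (λ a → ∑ M (λ b → (x a - x b) * (x a - x b))) ≡ + 2 * (+ M * Q-I M x - ∑ M x * ∑ M x)
  ∑∑-square-diff M x = begin
    ∑ M (λ a → ∑ M (λ b → (x a - x b) * (x a - x b)))  ≡⟨ ∑-cong M inner ⟩
    ∑ M (λ a → + M * (x a * x a) + S - + 2 * s * x a)  ≡⟨ ∑-- M _ _ ⟩
    ∑ M (λ a → + M * (x a * x a) + S) - ∑ M (λ a → + 2 * s * x a)
      ≡⟨ cong₂ _-_ (trans (∑-+ M _ _) (cong₂ _+_ (≡.sym (*-distribˡ-∑ M (+ M) _)) (∑-const M S)))
                   (≡.sym (*-distribˡ-∑ M (+ 2 * s) x)) ⟩
    + M * S + + M * S - + 2 * s * s                     ≡⟨ collect (+ M) S s ⟩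
    + 2 * (+ M * S - s * s)                             ∎
    where
    S = Q-I M x
    s = ∑ M x
    expand : ∀ p q → (p - q) * (p - q) ≡ p * p + q * q - + 2 * p * q
    expand = solve-∀
    reorder : ∀ p q r → p - + 2 * q * r ≡ p - + 2 * r * q
    reorder = solve-∀
    collect : ∀ m S s → m * S + m * S - + 2 * s * s ≡ + 2 * (m * S - s * s)
    collect = solve-∀
    inner : ∀ a → ∑ M (λ b → (x a - x b) * (x a - x b)) ≡ + M * (x a * x a) + S - + 2 * s * x a
    inner a = begin
      ∑ M (λ b → (x a - x b) * (x a - x b))                ≡⟨ ∑-cong M (λ b → expand (x a) (x b)) ⟩
      ∑ M (λ b → x a * x a + x b * x b - + 2 * x a * x b)  ≡⟨ ∑-- M _ _ ⟩
      ∑ M (λ b → x a * x a + x b * x b) - ∑ M (λ b → + 2 * x a * x b)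
        ≡⟨ cong₂ _-_ (trans (∑-+ M _ _) (cong (_+ S) (∑-const M (x a * x a))))
                     (≡.sym (*-distribˡ-∑ M (+ 2 * x a) x)) ⟩
      + M * (x a * x a) + S - + 2 * x a * s                ≡⟨ reorder (+ M * (x a * x a) + S) (x a) s ⟩
      + M * (x a * x a) + S - + 2 * s * x a                ∎

  cauchy-schwarz-∑ : ∀ M (x : Vec M) → ∑ M x * ∑ M x ≤ + M * Q-I M x
  cauchy-schwarz-∑ M x = ℤₚ.0≤i-j⇒j≤i (ℤₚ.*-cancelˡ-≤-pos 0ℤ _ (+ 2) 0≤2d)
    where
    0≤2d : + 2 * 0ℤ ≤ + 2 * (+ M * Q-I M x - ∑ M x * ∑ M x)
    0≤2d = subst (+ 2 * 0ℤ ≤_) (∑∑-square-diff M x)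
             (∑-nonneg M (λ a → ∑-nonneg M (λ b → square-nonneg (x a - x b))))

  ∑-squares-of-gram-transpose : ∀ N M (F : Fin N → Vec M) →
    ∑ N (λ s → ∑ N (λ t → F s · F t * (F s · F t)))
      ≡ ∑ M (λ x → ∑ M (λ y → transpose F x · transpose F y * (transpose F x · transpose F y)))
  ∑-squares-of-gram-transpose N M F = begin
    ∑ N (λ s → ∑ N (λ t → F s · F t * (F s · F t)))
      ≡⟨ ∑-cong N (λ s → ∑-cong N (λ t → ∑-mul M M _ _)) ⟩
    ∑ N (λ s → ∑ N (λ t → ∑ M (λ x → ∑ M (λ y → F s x * F t x * (F s y * F t y)))))
      ≡⟨ ∑-swap₄ N M _ ⟩
    ∑ M (λ x → ∑ M (λ y → ∑ N (λ s → ∑ N (λ t → F s x * F t x * (F s y * F t y)))))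
      ≡⟨ ∑-cong M (λ x → ∑-cong M (λ y → ∑-cong N (λ s → ∑-cong N (λ t →
           reorder (F s x) (F t x) (F s y) (F t y))))) ⟩
    ∑ M (λ x → ∑ M (λ y → ∑ N (λ s → ∑ N (λ t → F s x * F s y * (F t x * F t y)))))
      ≡⟨ ∑-cong M (λ x → ∑-cong M (λ y → ∑-mul N N _ _)) ⟨
    ∑ M (λ x → ∑ M (λ y → transpose F x · transpose F y * (transpose F x · transpose F y)))  ∎
    where reorder : ∀ p q r u → p * q * (r * u) ≡ p * r * (q * u)
          reorder = solve-∀

  module _ {N M} (F : Fin N → Vec M) {a} (orthogonal : ∀ s t → F s · F t ≡ a * δ (toℕ s) (toℕ t)) where

    ∑-gram²-orthogonal : ∑ N (λ s → ∑ N (λ t → F s · F t * (F s · F t))) ≡ + N * (a * a)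
    ∑-gram²-orthogonal = begin
      ∑ N (λ s → ∑ N (λ t → F s · F t * (F s · F t)))      ≡⟨ ∑-cong N (λ s → ∑-cong N (entry s)) ⟩
      ∑ N (λ s → ∑ N (λ t → δ (toℕ t) (toℕ s) * (a * a)))  ≡⟨ ∑-cong N (∑-δ N (λ _ → a * a)) ⟩
      ∑ N (λ _ → a * a)                                    ≡⟨ ∑-const N (a * a) ⟩
      + N * (a * a)                                        ∎
      where
      reorder : ∀ a d → a * d * (a * d) ≡ d * d * (a * a)
      reorder = solve-∀
      entry : ∀ s t → F s · F t * (F s · F t) ≡ δ (toℕ t) (toℕ s) * (a * a)
      entry s t rewrite orthogonal s t | δ-sym (toℕ s) (toℕ t) = begin
        a * d * (a * d)                   ≡⟨ reorder a d ⟩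
        d * d * (a * a)                   ≡⟨ cong (_* (a * a)) (δ-product (toℕ t) (toℕ s) (toℕ s)) ⟩
        d * δ (toℕ s) (toℕ s) * (a * a)  ≡⟨ cong (λ p → d * p * (a * a)) (δ-refl (toℕ s)) ⟩
        d * 1ℤ * (a * a)                  ≡⟨ cong (_* (a * a)) (ℤₚ.*-identityʳ d) ⟩
        d * (a * a)                       ∎
        where d = δ (toℕ t) (toℕ s)

    ∑-transpose-norms-orthogonal : ∑ M (λ x → transpose F x · transpose F x) ≡ + N * a
    ∑-transpose-norms-orthogonal = begin
      ∑ M (λ x → ∑ N (λ s → F s x * F s x))
        ≡⟨ ∑-swap M N (λ x s → F s x * F s x) ⟩
      ∑ N (λ s → F s · F s)
        ≡⟨ ∑-cong N (λ s → trans (orthogonal s s) (cong (a *_) (δ-refl (toℕ s)))) ⟩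
      ∑ N (λ _ → a * 1ℤ)      ≡⟨ ∑-const N (a * 1ℤ) ⟩
      + N * (a * 1ℤ)          ≡⟨ cong (+ N *_) (ℤₚ.*-identityʳ a) ⟩
      + N * a                 ∎

  -- Both sides of ∑-squares-of-gram-transpose are N a², while by Cauchy–Schwarz the diagonal
  -- terms of the right-hand side alone add up to at least (N a)² / M.
  orthogonal-family-size : ∀ N M (F : Fin N → Vec M) a → 0ℤ < a →
    (∀ s t → F s · F t ≡ a * δ (toℕ s) (toℕ t)) → N ℕ.≤ M
  orthogonal-family-size zero      M F a            _          _          = z≤n
  orthogonal-family-size (suc N)   M F +0           (ℤ.+<+ ()) _
  orthogonal-family-size N@(suc _) M F a@(+[1+ _ ]) _          orthogonal =
    ℤₚ.drop‿+≤+ (ℤₚ.*-cancelʳ-≤-pos (+ N) (+ M) (+ N * (a * a))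
      (subst (_≤ + M * (+ N * (a * a))) (regroup (+ N) a) bound))
    where
    regroup : ∀ n a → n * a * (n * a) ≡ n * (n * (a * a))
    regroup = solve-∀
    d : Vec M
    d x = transpose F x · transpose F x
    ∑d : ∑ M d ≡ + N * a
    ∑d = ∑-transpose-norms-orthogonal F {a} orthogonal
    diagonal≤all : Q-I M d ≤ ∑ N (λ s → ∑ N (λ t → F s · F t * (F s · F t)))
    diagonal≤all = subst (Q-I M d ≤_) (≡.sym (∑-squares-of-gram-transpose N M F))
      (∑-mono-≤ M (λ x → term≤∑ M (λ y → square-nonneg (transpose F x · transpose F y)) x))
    bound : + N * a * (+ N * a) ≤ + M * (+ N * (a * a))
    bound = subst₂ _≤_ (cong₂ _*_ ∑d ∑d) (cong (+ M *_) (∑-gram²-orthogonal F {a} orthogonal))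
      (ℤₚ.≤-trans (cauchy-schwarz-∑ M d) (ℤₚ.*-monoˡ-≤-nonNeg (+ M) diagonal≤all))

  lincomb : ∀ {P s} → Vec P → (Fin P → Vec s) → Vec s
  lincomb {P} c w j = ∑ P (λ i → c i * w i j)

  lincomb-+ : ∀ {P s} (c c′ : Vec P) (w : Fin P → Vec s) →
    lincomb (λ i → c i + c′ i) w ≗ (λ j → lincomb c w j + lincomb c′ w j)
  lincomb-+ {P} c c′ w j = trans (∑-cong P (λ i → ℤₚ.*-distribʳ-+ (w i j) (c i) (c′ i))) (∑-+ P _ _)

  lincomb-e : ∀ {P s} q (w : Fin P → Vec s) → lincomb (e (toℕ q)) w ≗ w q
  lincomb-e {P} q w j = ∑-δ P (λ i → w i j) q

  lincomb-last : ∀ {m s} (c : Vec (suc m)) (w : Fin (suc m) → Vec s) → (∀ q → IsZero (w (inject₁ q))) →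
    lincomb c w ≗ (λ j → c (fromℕ m) * w (fromℕ m) j)
  lincomb-last {m} c w init≡0 j = begin
    ∑ (suc m) (λ i → c i * w i j)                    ≡⟨ ∑-init-last m (λ i → c i * w i j) ⟩
    ∑ m (λ q → c (inject₁ q) * w (inject₁ q) j) + cw  ≡⟨ cong (_+ cw) (∑-zero m vanishes) ⟩
    0ℤ + cw                                          ≡⟨ ℤₚ.+-identityˡ cw ⟩
    cw                                               ∎
    where
    cw = c (fromℕ m) * w (fromℕ m) j
    vanishes : ∀ q → c (inject₁ q) * w (inject₁ q) j ≡ 0ℤ
    vanishes q = trans (cong (c (inject₁ q) *_) (init≡0 q j)) (ℤₚ.*-zeroʳ (c (inject₁ q)))

  ·-preserved-by-lincomb : ∀ {P M N} (u : Fin P → Vec M) (w : Fin P → Vec N) →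
    (∀ c → Q-I M (lincomb c u) ≡ Q-I N (lincomb c w)) →
    ∀ c c′ → lincomb c u · lincomb c′ u ≡ lincomb c w · lincomb c′ w
  ·-preserved-by-lincomb {P} {M} {N} u w Q≡ c c′ =
    ℤₚ.*-cancelˡ-≡ (+ 2) _ _ (∙-cancelˡ (Q-I N y + Q-I N y′) _ _ expanded)
    where
    x = lincomb c u
    x′ = lincomb c′ u
    y = lincomb c w
    y′ = lincomb c′ w
    expanded : Q-I N y + Q-I N y′ + + 2 * (x · x′) ≡ Q-I N y + Q-I N y′ + + 2 * (y · y′)
    expanded = begin
      Q-I N y + Q-I N y′ + + 2 * (x · x′)   ≡⟨ cong₂ (λ p q → p + q + + 2 * (x · x′)) (Q≡ c) (Q≡ c′) ⟨
      Q-I M x + Q-I M x′ + + 2 * (x · x′)   ≡⟨ Q-I-+ M x x′ ⟨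
      Q-I M (λ j → x j + x′ j)              ≡⟨ Q-I-cong M (lincomb-+ c c′ u) ⟨
      Q-I M (lincomb (λ i → c i + c′ i) u)  ≡⟨ Q≡ (λ i → c i + c′ i) ⟩
      Q-I N (lincomb (λ i → c i + c′ i) w)  ≡⟨ Q-I-cong N (lincomb-+ c c′ w) ⟩
      Q-I N (λ j → y j + y′ j)              ≡⟨ Q-I-+ N y y′ ⟩
      Q-I N y + Q-I N y′ + + 2 * (y · y′)   ∎

  module _ (L : ZLattice) where

    Q-cong : ∀ {x y : Vec (rank L)} → x ≗ y → Q L x ≡ Q L y
    Q-cong x≗y =
      ∑-cong (rank L) (λ i → ∑-cong (rank L) (λ j → cong₂ _*_ (cong (_* gram L i j) (x≗y i)) (x≗y j)))

    Q-scale : ∀ a (x : Vec (rank L)) → Q L (λ j → a * x j) ≡ a * a * Q L x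
    Q-scale a x = begin
      ∑ r (λ i → ∑ r (λ j → a * x i * gram L i j * (a * x j)))
        ≡⟨ ∑-cong r (λ i → ∑-cong r (λ j → reorder a (x i) (gram L i j) (x j))) ⟩
      ∑ r (λ i → ∑ r (λ j → a * a * (x i * gram L i j * x j)))
        ≡⟨ ∑-cong r (λ i → *-distribˡ-∑ r (a * a) _) ⟨
      ∑ r (λ i → a * a * ∑ r (λ j → x i * gram L i j * x j))
        ≡⟨ *-distribˡ-∑ r (a * a) _ ⟨
      a * a * Q L x  ∎
      where
      r = rank L
      reorder : ∀ a p g q → a * p * g * (a * q) ≡ a * a * (p * g * q)
      reorder = solve-∀

    Q-zero : ∀ {x : Vec (rank L)} → IsZero x → Q L x ≡ 0ℤ
    Q-zero {x} x≡0 = begin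
      Q L x                 ≡⟨ Q-cong (λ j → trans (x≡0 j) (≡.sym (ℤₚ.*-zeroˡ (x j)))) ⟩
      Q L (λ j → 0ℤ * x j)  ≡⟨ Q-scale 0ℤ x ⟩
      0ℤ * 0ℤ * Q L x       ≡⟨ ℤₚ.*-zeroˡ (Q L x) ⟩
      0ℤ                    ∎

    Q-nonneg : ∀ x → 0ℤ ≤ Q L x
    Q-nonneg x with Finₚ.all? (λ i → x i ℤ.≟ 0ℤ)
    ... | yes x≡0 = ℤₚ.≤-reflexive (≡.sym (Q-zero x≡0))
    ... | no  x≢0 = ℤₚ.<⇒≤ (posdef L x x≢0)

    Q<2⇒IsZero : MinAtLeast2 L → ∀ x → Q L x < + 2 → IsZero x
    Q<2⇒IsZero min≥2 x Q<2 with Finₚ.all? (λ i → x i ℤ.≟ 0ℤ)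
    ... | yes x≡0 = x≡0
    ... | no  x≢0 = contradiction (min≥2 x x≢0) (ℤₚ.<⇒≱ Q<2)

  -- The lattice A_{n,k}

  basisA-root : ∀ m k (a : Fin m) → basisA (suc m) k (inject₁ a) ≗ (λ j → e (suc (toℕ a)) j - e (toℕ a) j)
  basisA-root m k a j =
    trans (root (inject₁ a) (subst (ℕ._< m) (≡.sym (Finₚ.toℕ-inject₁ a)) (Finₚ.toℕ<n a)))
          (cong (λ t → e (suc t) j - e t j) (Finₚ.toℕ-inject₁ a))
    where
    root : ∀ i → toℕ i ℕ.< m → basisA (suc m) k i j ≡ δ (toℕ j) (suc (toℕ i)) - δ (toℕ j) (toℕ i)
    root i i<m with toℕ i ℕ.<? m
    ... | no i≮m = contradiction i<m i≮m
    ... | yes _ with toℕ j ℕ.≟ toℕ i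
    ...   | yes j≡i rewrite j≡i | δ-refl (toℕ i) | δ-≢ (ℕₚ.1+n≢n {toℕ i} ∘ ≡.sym) = refl
    ...   | no j≢i with toℕ j ℕ.≟ suc (toℕ i)
    ...     | yes j≡1+i rewrite j≡1+i | δ-refl (suc (toℕ i)) | δ-≢ (ℕₚ.1+n≢n {toℕ i}) = refl
    ...     | no j≢1+i rewrite δ-≢ j≢1+i | δ-≢ j≢i = refl

  basisA-last : ∀ m k → basisA (suc m) k (fromℕ m) ≗ (λ j → - step (suc m ∸ k) (toℕ j))
  basisA-last m k j with toℕ (fromℕ m) ℕ.<? m
  ... | yes m<m = contradiction (subst (ℕ._< m) (Finₚ.toℕ-fromℕ m) m<m) (ℕₚ.<-irrefl refl)
  ... | no _ with suc m ∸ k ℕ.≤? toℕ j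
  ...   | yes N≤j = cong -_ (≡.sym (step-≤ N≤j))
  ...   | no  N≰j = cong -_ (≡.sym (step-> (ℕₚ.≰⇒> N≰j)))

  elemA-root : ∀ m k (q : Fin m) →
    elemA (suc m) k (e (toℕ (inject₁ q))) ≗ (λ j → e (suc (toℕ q)) j - e (toℕ q) j)
  elemA-root m k q j = trans (lincomb-e (inject₁ q) (basisA (suc m) k) j) (basisA-root m k q j)

  Q-A-root : ∀ m k (q : Fin m) → Q-A (suc m) k (e (toℕ (inject₁ q))) ≡ + 2
  Q-A-root m k q = trans (Q-I-cong (suc m) (elemA-root m k q))
                         (Q-I-basis-diff (suc m) ℕₚ.1+n≢n (s≤s q<m) (ℕₚ.m≤n⇒m≤1+n q<m))
    where q<m = Finₚ.toℕ<n q

  Q-A-adjacent-roots : ∀ m k (q q′ : Fin m) → toℕ q′ ≡ suc (toℕ q) →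
    Q-A (suc m) k (λ i → e (toℕ (inject₁ q)) i + e (toℕ (inject₁ q′)) i) ≡ + 2
  Q-A-adjacent-roots m k q q′ q′≡1+q =
    trans (Q-I-cong (suc m) pair) (Q-I-basis-diff (suc m) 2+q≢q (s≤s 1+q<m) (ℕₚ.m≤n⇒m≤1+n (Finₚ.toℕ<n q)))
    where
    1+q<m : suc (toℕ q) ℕ.< m
    1+q<m = subst (ℕ._< m) q′≡1+q (Finₚ.toℕ<n q′)
    2+q≢q : suc (suc (toℕ q)) ≢ toℕ q
    2+q≢q = ℕₚ.<⇒≢ (ℕₚ.m<n⇒m<1+n (ℕₚ.n<1+n (toℕ q))) ∘ ≡.sym
    telescope : ∀ a b c → a - b + (c - a) ≡ c - b
    telescope = solve-∀
    pair : elemA (suc m) k (λ i → e (toℕ (inject₁ q)) i + e (toℕ (inject₁ q′)) i)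
             ≗ (λ j → e (suc (suc (toℕ q))) j - e (toℕ q) j)
    pair j = begin
      elemA (suc m) k (λ i → e (toℕ (inject₁ q)) i + e (toℕ (inject₁ q′)) i) j
        ≡⟨ lincomb-+ (e (toℕ (inject₁ q))) (e (toℕ (inject₁ q′))) (basisA (suc m) k) j ⟩
      elemA (suc m) k (e (toℕ (inject₁ q))) j + elemA (suc m) k (e (toℕ (inject₁ q′))) j
        ≡⟨ cong₂ _+_ (elemA-root m k q j) (elemA-root m k q′ j) ⟩
      e (suc (toℕ q)) j - e (toℕ q) j + (e (suc (toℕ q′)) j - e (toℕ q′) j)
        ≡⟨ cong (λ t → e (suc (toℕ q)) j - e (toℕ q) j + (e (suc t) j - e t j)) q′≡1+q ⟩
      e (suc (toℕ q)) j - e (toℕ q) j + (e (suc (suc (toℕ q))) j - e (suc (toℕ q)) j)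
        ≡⟨ telescope (e (suc (toℕ q)) j) (e (toℕ q) j) (e (suc (suc (toℕ q))) j) ⟩
      e (suc (suc (toℕ q))) j - e (toℕ q) j  ∎

  coeffs : ∀ m → (ℕ → ℤ) → ℤ → Vec (suc m)
  coeffs zero    f l zero    = l
  coeffs (suc m) f l zero    = f 0
  coeffs (suc m) f l (suc i) = coeffs m (f ∘ suc) l i

  coeffs-inject₁ : ∀ m f l (a : Fin m) → coeffs m f l (inject₁ a) ≡ f (toℕ a)
  coeffs-inject₁ (suc m) f l zero    = refl
  coeffs-inject₁ (suc m) f l (suc a) = coeffs-inject₁ m (f ∘ suc) l a

  coeffs-last : ∀ m f l → coeffs m f l (fromℕ m) ≡ l
  coeffs-last zero    f l = refl
  coeffs-last (suc m) f l = coeffs-last m (f ∘ suc) l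

  partial : (ℕ → ℤ) → ℕ → ℤ
  partial g zero    = 0ℤ
  partial g (suc b) = partial g b + g b

  partial-+ : ∀ f g b → partial (λ a → f a + g a) b ≡ partial f b + partial g b
  partial-+ f g zero    = refl
  partial-+ f g (suc b) =
    trans (cong (_+ (f b + g b)) (partial-+ f g b)) (swap (partial f b) (partial g b) (f b) (g b))
    where swap : ∀ p q r s → p + q + (r + s) ≡ p + r + (q + s)
          swap = solve-∀

  partial-*ˡ : ∀ l f b → partial (λ a → l * f a) b ≡ l * partial f b
  partial-*ˡ l f zero    = ≡.sym (ℤₚ.*-zeroʳ l)
  partial-*ˡ l f (suc b) =
    trans (cong (_+ l * f b) (partial-*ˡ l f b)) (≡.sym (ℤₚ.*-distribˡ-+ l (partial f b) (f b)))

  partial-const : ∀ c b → partial (λ _ → c) b ≡ + b * c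
  partial-const c zero    = ≡.sym (ℤₚ.*-zeroˡ c)
  partial-const c (suc b) = trans (cong (_+ c) (partial-const c b)) (≡.sym (distrib (+ b) c))
    where distrib : ∀ b c → (1ℤ + b) * c ≡ b * c + c
          distrib = solve-∀

  partial-δ : ∀ t b → partial (λ a → δ a t) b ≡ step (suc t) b
  partial-δ t zero    = refl
  partial-δ t (suc b) = trans (cong (_+ δ b t) (partial-δ t b)) (≡.sym (step-suc t b))

  ramp-suc : ∀ N b → + (suc b ∸ N) ≡ + (b ∸ N) + step N b
  ramp-suc zero    b       = cong +_ (ℕₚ.+-comm 1 b)
  ramp-suc (suc N) zero    = cong +_ (ℕₚ.0∸n≡0 N)
  ramp-suc (suc N) (suc b) = ramp-suc N b

  partial-step : ∀ N b → partial (step N) b ≡ + (b ∸ N)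
  partial-step N zero    = cong +_ (≡.sym (ℕₚ.0∸n≡0 N))
  partial-step N (suc b) = trans (cong (_+ step N b) (partial-step N b)) (≡.sym (ramp-suc N b))

  ∑-roots-telescope : ∀ m (P : ℕ → ℤ) → P 0 ≡ 0ℤ → P (suc m) ≡ 0ℤ → ∀ {b} → b ℕ.≤ m →
    ∑ m (λ a → P (suc (toℕ a)) * (δ b (suc (toℕ a)) - δ b (toℕ a))) ≡ P b - P (suc b)
  ∑-roots-telescope m P P0≡0 Pn≡0 {b} b≤m = begin
    ∑ m (λ a → P (suc (toℕ a)) * (δ b (suc (toℕ a)) - δ b (toℕ a)))
      ≡⟨ ∑-cong m (λ a → distrib (P (suc (toℕ a))) (δ-sym b (suc (toℕ a))) (δ-sym b (toℕ a))) ⟩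
    ∑ m (λ a → δ (suc (toℕ a)) b * P (suc (toℕ a)) - δ (toℕ a) b * P (suc (toℕ a)))
      ≡⟨ ∑-- m _ _ ⟩
    ∑ m (λ a → δ (suc (toℕ a)) b * P (suc (toℕ a))) - ∑ m (λ a → δ (toℕ a) b * P (suc (toℕ a)))
      ≡⟨ cong₂ _-_ (∑-δ-suc m P b≤m P0≡0) (∑-δ-≤ m (P ∘ suc) b≤m Pn≡0) ⟩
    P b - P (suc b)  ∎
    where
    distrib : ∀ {d d′ f f′} p → d ≡ d′ → f ≡ f′ → p * (d - f) ≡ d′ * p - f′ * p
    distrib {d} {f = f} p refl refl = ring p d f
      where ring : ∀ p d f → p * (d - f) ≡ d * p - f * p
            ring = solve-∀

  -- x − l·b_{n−1} = x + l·(e_{n−k} + ⋯ + e_{n−1}) lies in the span of the roots, and its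
  -- coordinate on the root b_a = e_{a+1} − e_a is minus its partial sum up to index a.
  rootPart : ℕ → ℕ → (ℕ → ℤ) → ℤ → ℕ → ℤ
  rootPart m k x l b = x b + l * step (suc m ∸ k) b

  coordinates : ∀ m k → (ℕ → ℤ) → ℤ → Vec (suc m)
  coordinates m k x l = coeffs m (λ a → - partial (rootPart m k x l) (suc a)) l

  elemA-coordinates : ∀ m k (x : ℕ → ℤ) l → k ℕ.≤ suc m → partial x (suc m) + l * + k ≡ 0ℤ →
    elemA (suc m) k (coordinates m k x l) ≗ (x ∘ toℕ)
  elemA-coordinates m k x l k≤n ∑x≡-lk j = begin
    ∑ (suc m) (λ i → c i * basisA (suc m) k i j)
      ≡⟨ ∑-init-last m (λ i → c i * basisA (suc m) k i j) ⟩
    ∑ m (λ a → c (inject₁ a) * basisA (suc m) k (inject₁ a) j) + c (fromℕ m) * basisA (suc m) k (fromℕ m) j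
      ≡⟨ cong₂ _+_ (∑-cong m (λ a → cong₂ _*_ (coeffs-inject₁ m _ l a) (basisA-root m k a j)))
                   (cong₂ _*_ (coeffs-last m _ l) (basisA-last m k j)) ⟩
    ∑ m (λ a → P (suc (toℕ a)) * (δ b (suc (toℕ a)) - δ b (toℕ a))) + l * - step N₀ b
      ≡⟨ cong (_+ l * - step N₀ b) (∑-roots-telescope m P refl P[n]≡0 (ℕₚ.≤-pred (Finₚ.toℕ<n j))) ⟩
    P b - P (suc b) + l * - step N₀ b
      ≡⟨ telescoped (partial g b) (x b) l (step N₀ b) ⟩
    x b  ∎
    where
    b = toℕ j
    N₀ = suc m ∸ k
    g = rootPart m k x l
    c = coordinates m k x l
    P : ℕ → ℤ
    P a = - partial g a
    telescoped : ∀ p x l s → - p - - (p + (x + l * s)) + l * - s ≡ x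
    telescoped = solve-∀
    P[n]≡0 : P (suc m) ≡ 0ℤ
    P[n]≡0 = cong -_ (begin
      partial g (suc m)
        ≡⟨ partial-+ x _ (suc m) ⟩
      partial x (suc m) + partial (λ a → l * step N₀ a) (suc m)
        ≡⟨ cong (_+_ (partial x (suc m))) (partial-*ˡ l (step N₀) (suc m)) ⟩
      partial x (suc m) + l * partial (step N₀) (suc m)
        ≡⟨ cong (λ p → partial x (suc m) + l * p) (partial-step N₀ (suc m)) ⟩
      partial x (suc m) + l * + (suc m ∸ N₀)
        ≡⟨ cong (λ p → partial x (suc m) + l * + p) (ℕₚ.m∸[m∸n]≡n k≤n) ⟩
      partial x (suc m) + l * + k
        ≡⟨ ∑x≡-lk ⟩
      0ℤ  ∎)

  coords-k∑e : ∀ m → ℕ → Vec (suc m)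
  coords-k∑e m k = coordinates m k (λ _ → + k) (- + suc m)

  elemA-coords-k∑e : ∀ m k → k ℕ.≤ suc m → elemA (suc m) k (coords-k∑e m k) ≗ (λ _ → + k)
  elemA-coords-k∑e m k k≤n = elemA-coordinates m k (λ _ → + k) (- + suc m) k≤n
    (trans (cong (_+ - + suc m * + k) (partial-const (+ k) (suc m))) (cancel (+ suc m) (+ k)))
    where cancel : ∀ n k → n * k + - n * k ≡ 0ℤ
          cancel = solve-∀

  Q-A-coords-k∑e : ∀ m k → k ℕ.≤ suc m → Q-A (suc m) k (coords-k∑e m k) ≡ + suc m * + (k ℕ.* k)
  Q-A-coords-k∑e m k k≤n = begin
    Q-I (suc m) (elemA (suc m) k (coords-k∑e m k))  ≡⟨ Q-I-cong (suc m) (elemA-coords-k∑e m k k≤n) ⟩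
    ∑ (suc m) (λ _ → + k * + k)                     ≡⟨ ∑-const (suc m) (+ k * + k) ⟩
    + suc m * (+ k * + k)                           ≡⟨ cong (+ suc m *_) (ℤₚ.pos-* k k) ⟨
    + suc m * + (k ℕ.* k)                           ∎

  coords-ke : ∀ m → ℕ → Fin (suc m) → Vec (suc m)
  coords-ke m k t = coordinates m k (λ a → + k * δ a (toℕ t)) -1ℤ

  elemA-coords-ke : ∀ m k t → k ℕ.≤ suc m → elemA (suc m) k (coords-ke m k t) ≗ (λ j → + k * e (toℕ t) j)
  elemA-coords-ke m k t k≤n = elemA-coordinates m k (λ a → + k * δ a (toℕ t)) -1ℤ k≤n (begin
    partial (λ a → + k * δ a (toℕ t)) (suc m) + -1ℤ * + k
      ≡⟨ cong (_+ -1ℤ * + k) (partial-*ˡ (+ k) (λ a → δ a (toℕ t)) (suc m)) ⟩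
    + k * partial (λ a → δ a (toℕ t)) (suc m) + -1ℤ * + k
      ≡⟨ cong (λ p → + k * p + -1ℤ * + k) (partial-δ (toℕ t) (suc m)) ⟩
    + k * step (toℕ t) m + -1ℤ * + k
      ≡⟨ cong (λ p → + k * p + -1ℤ * + k) (step-≤ (ℕₚ.≤-pred (Finₚ.toℕ<n t))) ⟩
    + k * 1ℤ + -1ℤ * + k
      ≡⟨ cancel (+ k) ⟩
    0ℤ  ∎)
    where cancel : ∀ k → k * 1ℤ + -1ℤ * k ≡ 0ℤ
          cancel = solve-∀

  a+b≡c≤b⇒a≤0 : ∀ {a b c} → a + b ≡ c → c ≤ b → a ≤ 0ℤ
  a+b≡c≤b⇒a≤0 {a} {b} {c} a+b≡c c≤b =
    subst (_≤ 0ℤ) (trans (cong (_- b) (≡.sym a+b≡c)) (cancel a b)) (ℤₚ.i≤j⇒i-j≤0 c≤b)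
    where cancel : ∀ a b → a + b - b ≡ a
          cancel = solve-∀

  scaled-bound⇒0 : ∀ {n s} γ R → s ℕ.< n → 0ℤ ≤ γ → 0ℤ ≤ R → + n * + n * γ + R ≡ + n * + s → γ ≡ 0ℤ
  scaled-bound⇒0 +0 _ _ _ _ _ = refl
  scaled-bound⇒0 {suc n} {s} +[1+ g ] R s<n _ 0≤R eq = contradiction (ℤₚ.≤-reflexive eq) (ℤₚ.<⇒≱ ns<nnγ+R)
    where
    nn = + suc n * + suc n
    ns<nn : + suc n * + s < nn
    ns<nn = ℤₚ.*-monoˡ-<-pos (+ suc n) (ℤ.+<+ s<n)
    nn≤nnγ : nn ≤ nn * +[1+ g ]
    nn≤nnγ = ℤₚ.≤-trans (ℤₚ.≤-reflexive (≡.sym (ℤₚ.*-identityʳ nn)))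
                        (ℤₚ.*-monoˡ-≤-nonNeg nn (ℤ.+≤+ (s≤s z≤n)))
    ns<nnγ+R : + suc n * + s < nn * +[1+ g ] + R
    ns<nnγ+R = ℤₚ.<-≤-trans ns<nn (ℤₚ.≤-trans nn≤nnγ (ℤₚ.i≤i+j _ R ⦃ ℤ.nonNegative 0≤R ⦄))

  neg-square : ∀ a b → - a * - a * b ≡ a * a * b
  neg-square = solve-∀

  m*m<n⇒m≤n : ∀ {m n} → m ℕ.* m ℕ.< n → m ℕ.≤ n
  m*m<n⇒m≤n {zero}  _    = z≤n
  m*m<n⇒m≤n {suc m} mm<n = ℕₚ.≤-trans (ℕₚ.m≤m*n (suc m) (suc m)) (ℕₚ.<⇒≤ mm<n)

  dichotomy-propagates : ∀ {m} (A B : Fin m → Set) → (∀ q → A q ⊎ B q) →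
    (∀ {q q′} → toℕ q′ ≡ suc (toℕ q) → A q → A q′) →
    (∀ {q q′} → toℕ q′ ≡ suc (toℕ q) → B q → B q′) →
    (∀ q → A q) ⊎ (∀ q → B q)
  dichotomy-propagates {zero}  A B _   _    _    = inj₁ (λ ())
  dichotomy-propagates {suc m} A B A⊎B A→A′ B→B′ with A⊎B zero
  ... | inj₁ A₀ = inj₁ (<-weakInduction A A₀ (λ i → A→A′ (cong suc (≡.sym (Finₚ.toℕ-inject₁ i)))))
  ... | inj₂ B₀ = inj₂ (<-weakInduction B B₀ (λ i → B→B′ (cong suc (≡.sym (Finₚ.toℕ-inject₁ i)))))

  -- Representations of A_{m+1,k} in I_m ⊥ L

  module Representation (m k : ℕ) (L : ZLattice) (min≥2 : MinAtLeast2 L)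
                        (v : Fin (suc m) → Perp m L) (rep : IsRepresentation (suc m) k m L v) where

    y : Fin (suc m) → Vec m
    y i = proj₁ (v i)

    z : Fin (suc m) → Vec (rank L)
    z i = proj₂ (v i)

    image-norm : ∀ c {a b} → lincomb c y ≗ a → lincomb c z ≗ b → Q-I m a + Q L b ≡ Q-A (suc m) k c
    image-norm c y≗a z≗b = trans (cong₂ _+_ (Q-I-cong m (≡.sym ∘ y≗a)) (Q-cong L (≡.sym ∘ z≗b))) (rep c)

    RootInI RootInL : Fin m → Set
    RootInI q = IsZero (z (inject₁ q))
    RootInL q = IsZero (y (inject₁ q))

    root-norm : ∀ q → Q-I m (y (inject₁ q)) + Q L (z (inject₁ q)) ≡ + 2
    root-norm q = trans (image-norm (e (toℕ r)) (lincomb-e r y) (lincomb-e r z)) (Q-A-root m k q)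
      where r = inject₁ q

    adjacent-roots-norm : ∀ {q q′} → toℕ q′ ≡ suc (toℕ q) →
      Q-I m (λ j → y (inject₁ q) j + y (inject₁ q′) j) + Q L (λ j → z (inject₁ q) j + z (inject₁ q′) j) ≡ + 2
    adjacent-roots-norm {q} {q′} q′≡1+q =
      trans (image-norm (λ i → e (toℕ r) i + e (toℕ r′) i) (image y) (image z))
            (Q-A-adjacent-roots m k q q′ q′≡1+q)
      where
      r = inject₁ q
      r′ = inject₁ q′
      image : ∀ {s} (w : Fin (suc m) → Vec s) →
        lincomb (λ i → e (toℕ r) i + e (toℕ r′) i) w ≗ (λ j → w r j + w r′ j)
      image w j =
        trans (lincomb-+ (e (toℕ r)) (e (toℕ r′)) w j) (cong₂ _+_ (lincomb-e r w j) (lincomb-e r′ w j))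

    root-in-one-summand : ∀ q → RootInI q ⊎ RootInL q
    root-in-one-summand q with Q L (z (inject₁ q)) ℤ.<? + 2
    ... | yes Q<2 = inj₁ (Q<2⇒IsZero L min≥2 (z (inject₁ q)) Q<2)
    ... | no  Q≮2 = inj₂ (Q-I≡0⇒IsZero m (y (inject₁ q)) (ℤₚ.≤-antisym Q-I≤0 (Q-I-nonneg m (y (inject₁ q)))))
      where Q-I≤0 = a+b≡c≤b⇒a≤0 (root-norm q) (ℤₚ.≮⇒≥ Q≮2)

    norm-in-I : ∀ {q} → RootInI q → Q-I m (y (inject₁ q)) ≡ + 2
    norm-in-I {q} inI = begin
      Q-I m (y (inject₁ q))                        ≡⟨ ℤₚ.+-identityʳ _ ⟨
      Q-I m (y (inject₁ q)) + 0ℤ                   ≡⟨ cong (_+_ (Q-I m (y (inject₁ q)))) (Q-zero L inI) ⟨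
      Q-I m (y (inject₁ q)) + Q L (z (inject₁ q))  ≡⟨ root-norm q ⟩
      + 2                                          ∎

    norm-in-L : ∀ {q} → RootInL q → Q L (z (inject₁ q)) ≡ + 2
    norm-in-L {q} inL = begin
      Q L (z (inject₁ q))                          ≡⟨ ℤₚ.+-identityˡ _ ⟨
      0ℤ + Q L (z (inject₁ q))                     ≡⟨ cong (_+ Q L (z (inject₁ q))) (Q-I-zero m inL) ⟨
      Q-I m (y (inject₁ q)) + Q L (z (inject₁ q))  ≡⟨ root-norm q ⟩
      + 2                                          ∎

    adjacent-roots-not-split : ∀ {q q′} → toℕ q′ ≡ suc (toℕ q) →
      (RootInI q × RootInL q′) ⊎ (RootInL q × RootInI q′) → ⊥
    adjacent-roots-not-split {q} {q′} adj split =
      contradiction (trans (≡.sym (adjacent-roots-norm adj)) (norm-of-split split)) λ ()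
      where
      +0ʳ : ∀ {s} (a : Vec s) {b : Vec s} → IsZero b → (λ j → a j + b j) ≗ a
      +0ʳ a b≡0 j = trans (cong (_+_ (a j)) (b≡0 j)) (ℤₚ.+-identityʳ (a j))
      +0ˡ : ∀ {s} {a : Vec s} (b : Vec s) → IsZero a → (λ j → a j + b j) ≗ b
      +0ˡ b a≡0 j = trans (cong (_+ b j) (a≡0 j)) (ℤₚ.+-identityˡ (b j))
      norm-of-split : (RootInI q × RootInL q′) ⊎ (RootInL q × RootInI q′) →
        Q-I m (λ j → y (inject₁ q) j + y (inject₁ q′) j) + Q L (λ j → z (inject₁ q) j + z (inject₁ q′) j) ≡ + 4
      norm-of-split (inj₁ (inI , inL′)) =
        cong₂ _+_ (trans (Q-I-cong m (+0ʳ (y (inject₁ q)) inL′)) (norm-in-I inI))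
                  (trans (Q-cong L (+0ˡ (z (inject₁ q′)) inI)) (norm-in-L inL′))
      norm-of-split (inj₂ (inL , inI′)) =
        cong₂ _+_ (trans (Q-I-cong m (+0ˡ (y (inject₁ q′)) inL)) (norm-in-I inI′))
                  (trans (Q-cong L (+0ʳ (z (inject₁ q)) inI′)) (norm-in-L inL))

    roots-in-one-summand : (∀ q → RootInI q) ⊎ (∀ q → RootInL q)
    roots-in-one-summand = dichotomy-propagates RootInI RootInL root-in-one-summand I→I L→L
      where
      I→I : ∀ {q q′} → toℕ q′ ≡ suc (toℕ q) → RootInI q → RootInI q′
      I→I {q′ = q′} adj inI with root-in-one-summand q′
      ... | inj₁ inI′ = inI′
      ... | inj₂ inL′ = ⊥-elim (adjacent-roots-not-split adj (inj₁ (inI , inL′)))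
      L→L : ∀ {q q′} → toℕ q′ ≡ suc (toℕ q) → RootInL q → RootInL q′
      L→L {q′ = q′} adj inL with root-in-one-summand q′
      ... | inj₁ inI′ = ⊥-elim (adjacent-roots-not-split adj (inj₂ (inL , inI′)))
      ... | inj₂ inL′ = inL′

    image-of-k∑e : k ℕ.* k ℕ.< suc m →
      Q-I m (lincomb (coords-k∑e m k) y) + Q L (lincomb (coords-k∑e m k) z) ≡ + suc m * + (k ℕ.* k)
    image-of-k∑e kk<n = trans (rep (coords-k∑e m k)) (Q-A-coords-k∑e m k (m*m<n⇒m≤n kk<n))

    lincomb-k∑e : ∀ {s} (w : Fin (suc m) → Vec s) → (∀ q → IsZero (w (inject₁ q))) →
      lincomb (coords-k∑e m k) w ≗ (λ j → - + suc m * w (fromℕ m) j)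
    lincomb-k∑e w roots≡0 j = trans (lincomb-last (coords-k∑e m k) w roots≡0 j)
                                    (cong (_* w (fromℕ m) j) (coeffs-last m _ (- + suc m)))

    last-image-in-L : (∀ q → RootInL q) → k ℕ.* k ℕ.< suc m → IsZero (y (fromℕ m))
    last-image-in-L inL kk<n =
      Q-I≡0⇒IsZero m (y (fromℕ m))
        (scaled-bound⇒0 γ (Q L φL) kk<n (Q-I-nonneg m (y (fromℕ m))) (Q-nonneg L φL) norms)
      where
      γ = Q-I m (y (fromℕ m))
      φL = lincomb (coords-k∑e m k) z
      Q-I-φI : Q-I m (lincomb (coords-k∑e m k) y) ≡ + suc m * + suc m * γ
      Q-I-φI = begin
        Q-I m (lincomb (coords-k∑e m k) y)        ≡⟨ Q-I-cong m (lincomb-k∑e y inL) ⟩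
        Q-I m (λ j → - + suc m * y (fromℕ m) j)  ≡⟨ Q-I-scale m (- + suc m) (y (fromℕ m)) ⟩
        - + suc m * - + suc m * γ                 ≡⟨ neg-square (+ suc m) γ ⟩
        + suc m * + suc m * γ                     ∎
      norms : + suc m * + suc m * γ + Q L φL ≡ + suc m * + (k ℕ.* k)
      norms = trans (cong (_+ Q L φL) (≡.sym Q-I-φI)) (image-of-k∑e kk<n)

    last-image-in-I : (∀ q → RootInI q) → k ℕ.* k ℕ.< suc m → Q L (z (fromℕ m)) ≡ 0ℤ
    last-image-in-I inI kk<n =
      scaled-bound⇒0 γ (Q-I m φI) kk<n (Q-nonneg L (z (fromℕ m))) (Q-I-nonneg m φI) norms
      where
      γ = Q L (z (fromℕ m))
      φI = lincomb (coords-k∑e m k) y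
      Q-φL : Q L (lincomb (coords-k∑e m k) z) ≡ + suc m * + suc m * γ
      Q-φL = begin
        Q L (lincomb (coords-k∑e m k) z)        ≡⟨ Q-cong L (lincomb-k∑e z inI) ⟩
        Q L (λ j → - + suc m * z (fromℕ m) j)  ≡⟨ Q-scale L (- + suc m) (z (fromℕ m)) ⟩
        - + suc m * - + suc m * γ               ≡⟨ neg-square (+ suc m) γ ⟩
        + suc m * + suc m * γ                   ∎
      norms : + suc m * + suc m * γ + Q-I m φI ≡ + suc m * + (k ℕ.* k)
      norms = trans (trans (cong (_+ Q-I m φI) (≡.sym Q-φL)) (ℤₚ.+-comm _ (Q-I m φI))) (image-of-k∑e kk<n)

    isometry-into-I : (∀ q → RootInI q) → k ℕ.* k ℕ.< suc m → ∀ c → Q-I m (lincomb c y) ≡ Q-A (suc m) k c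
    isometry-into-I inI kk<n c = begin
      Q-I m (lincomb c y)                      ≡⟨ ℤₚ.+-identityʳ _ ⟨
      Q-I m (lincomb c y) + 0ℤ                 ≡⟨ cong (_+_ (Q-I m (lincomb c y))) Q-φL≡0 ⟨
      Q-I m (lincomb c y) + Q L (lincomb c z)  ≡⟨ rep c ⟩
      Q-A (suc m) k c                          ∎
      where
      cₙ = c (fromℕ m)
      Q-φL≡0 : Q L (lincomb c z) ≡ 0ℤ
      Q-φL≡0 = begin
        Q L (lincomb c z)                  ≡⟨ Q-cong L (lincomb-last c z inI) ⟩
        Q L (λ j → cₙ * z (fromℕ m) j)    ≡⟨ Q-scale L cₙ (z (fromℕ m)) ⟩
        cₙ * cₙ * Q L (z (fromℕ m))        ≡⟨ cong (cₙ * cₙ *_) (last-image-in-I inI kk<n) ⟩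
        cₙ * cₙ * 0ℤ                       ≡⟨ ℤₚ.*-zeroʳ (cₙ * cₙ) ⟩
        0ℤ                                 ∎

    roots-in-I-impossible : (∀ q → RootInI q) → 0 ℕ.< k → k ℕ.* k ℕ.< suc m → ⊥
    roots-in-I-impossible inI 0<k kk<n =
      ℕₚ.<-irrefl refl (orthogonal-family-size (suc m) m F (+ k * + k) 0<k² orthogonal)
      where
      k≤n = m*m<n⇒m≤n kk<n
      F : Fin (suc m) → Vec m
      F t = lincomb (coords-ke m k t) y
      0<k² : 0ℤ < + k * + k
      0<k² = subst (0ℤ <_) (ℤₚ.pos-* k k) (ℤ.+<+ (ℕₚ.*-mono-< 0<k 0<k))
      orthogonal : ∀ s t → F s · F t ≡ + k * + k * δ (toℕ s) (toℕ t)
      orthogonal s t = begin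
        F s · F t
          ≡⟨ ·-preserved-by-lincomb y (basisA (suc m) k) (isometry-into-I inI kk<n)
                                    (coords-ke m k s) (coords-ke m k t) ⟩
        elemA (suc m) k (coords-ke m k s) · elemA (suc m) k (coords-ke m k t)
          ≡⟨ ·-cong (elemA-coords-ke m k s k≤n) (elemA-coords-ke m k t k≤n) ⟩
        ∑ (suc m) (λ j → + k * e (toℕ s) j * (+ k * e (toℕ t) j))
          ≡⟨ ·-scaled-basis (suc m) (+ k) (+ k) (toℕ t) (Finₚ.toℕ<n s) ⟩
        + k * + k * δ (toℕ s) (toℕ t)  ∎

    roots-in-L⇒I-part-vanishes : (∀ q → RootInL q) → k ℕ.* k ℕ.< suc m → ∀ c → IsZero (lincomb c y)
    roots-in-L⇒I-part-vanishes inL kk<n c j = begin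
      lincomb c y j                ≡⟨ lincomb-last c y inL j ⟩
      c (fromℕ m) * y (fromℕ m) j  ≡⟨ cong (c (fromℕ m) *_) (last-image-in-L inL kk<n j) ⟩
      c (fromℕ m) * 0ℤ             ≡⟨ ℤₚ.*-zeroʳ (c (fromℕ m)) ⟩
      0ℤ                           ∎

    I-part-vanishes : 0 ℕ.< k → k ℕ.* k ℕ.< suc m → ∀ c → IsZero (lincomb c y)
    I-part-vanishes 0<k kk<n with roots-in-one-summand
    ... | inj₁ inI = ⊥-elim (roots-in-I-impossible inI 0<k kk<n)
    ... | inj₂ inL = roots-in-L⇒I-part-vanishes inL kk<n

open import Data.Nat using (ℕ; _<_; _≤_; _*_; _∸_)
open import Data.Product using (proj₁)
open import Data.Fin using (Fin)
open import Data.Nat using (suc)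
open import Data.Nat.Properties using (<-trans; 0<1+n)

lemma4p1 : (n k : ℕ) → 1 < k → k ≤ n ∸ 1 → k * k < n →
    (L : ZLattice) → MinAtLeast2 L →
    (v : Fin n → Perp (n ∸ 1) L) → IsRepresentation n k (n ∸ 1) L v →
    (c : Vec n) → IsZero (proj₁ (linExt n (n ∸ 1) L v c))
lemma4p1 0       k _   _ ()
lemma4p1 (suc m) k 1<k _ k*k<n L min≥2 v rep =
  Representation.I-part-vanishes m k L min≥2 v rep (<-trans 0<1+n 1<k) k*k<n
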